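{- Let $n>2$ and let $T_{n+1}$ be a tree of order $n+1$. Then $\sigma^{ - }(T_{n+1})=\left\lceil \frac{n}{2}\right\rceil$ if and only if $T_{n+1}=K_{1,n}$.
   Context: For a connected simple graph $G$ of order $p$, a parity labelling is a bijection $f:V(G)\to\{1,\ldots,p\}$; an edge $uv$ is negative if $f(u),f(v)$ have opposite parity. The rna number $\sigma^{ - }(G)$ is the minimum over all such $f$ of the number of negative edges. $K_{1,n}$ denotes the star with $n$ leaves. -}

module Defs where

open import Data.Nat using (ℕ; zero; suc; _+_; _≤_; _<_; _<ᵇ_)
open import Data.Bool using (Bool; true; false; _∧_; _xor_; T; not)
open import Data.Fin using (Fin; toℕ; zero; suc)
open import Data.List using (List; []; _∷_; allFin; concatMap; map; filterᵇ; length)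
open import Data.Product using (_×_; _,_; ∃; Σ; proj₁; proj₂)
open import Function.Bundles using (_⤖_; Bijection)
open import Function.Definitions using (Injective)
open import Relation.Binary.PropositionalEquality using (_≡_)

record Graph (p : ℕ) : Set where
  field
    adj     : Fin p → Fin p → Bool
    symm    : ∀ u v → adj u v ≡ adj v u
    irrefl  : ∀ u → adj u u ≡ false
open Graph public

data Walk {p : ℕ} (G : Graph p) : Fin p → Fin p → Set where
  here : ∀ {u} → Walk G u u
  step : ∀ {u w v} → T (adj G u w) → Walk G w v → Walk G u v

Connected : ∀ {p} → Graph p → Set
Connected G = ∀ u v → Walk G u v

-- Successor modulo (suc k) on Fin (suc k) indices, for closing cycles.
nextIdx : ∀ {k} → Fin (suc k) → Fin (suc k)
nextIdx {zero} i = i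
nextIdx {suc k} zero = suc zero
nextIdx {suc k} (suc i) with nextIdx {k} i
... | zero = zero
... | suc j = suc (suc j)

-- A cycle of length k+3 (≥ 3): distinct vertices c 0, …, c (k+2),
-- consecutive ones (cyclically) adjacent.
Cycle : ∀ {p} → Graph p → Set
Cycle {p} G = Σ ℕ λ k → Σ (Fin (suc (suc (suc k))) → Fin p) λ c →
  Injective _≡_ _≡_ c × (∀ i → T (adj G (c i) (c (nextIdx i))))

Acyclic : ∀ {p} → Graph p → Set
Acyclic G = Cycle G → Data.Empty.⊥
  where import Data.Empty

IsTree : ∀ {p} → Graph p → Set
IsTree G = Connected G × Acyclic G

-- The star K_{1,n} on Fin (suc n): centre zero, adjacent to every other vertex.
isZero : ∀ {m} → Fin m → Bool
isZero zero = true
isZero (suc _) = false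

star : (n : ℕ) → Graph (suc n)
star n = record { adj = λ u v → isZero u xor isZero v ; symm = sy ; irrefl = ir }
  where
  sy : ∀ u v → (isZero u xor isZero v) ≡ (isZero v xor isZero u)
  sy zero zero = Relation.Binary.PropositionalEquality.refl
  sy zero (suc v) = Relation.Binary.PropositionalEquality.refl
  sy (suc u) zero = Relation.Binary.PropositionalEquality.refl
  sy (suc u) (suc v) = Relation.Binary.PropositionalEquality.refl
  ir : ∀ u → (isZero u xor isZero u) ≡ false
  ir zero = Relation.Binary.PropositionalEquality.refl
  ir (suc u) = Relation.Binary.PropositionalEquality.refl

Isomorphic : ∀ {p} → Graph p → Graph p → Set
Isomorphic {p} G H = Σ (Fin p ⤖ Fin p) λ φ →
  ∀ u v → adj G u v ≡ adj H (Bijection.to φ u) (Bijection.to φ v)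

isEven : ℕ → Bool
isEven zero = true
isEven (suc n) = not (isEven n)

-- A parity labelling: bijection f : V → {1,…,p}; vertex i gets label toℕ (f i) + 1.
Labelling : ℕ → Set
Labelling p = Fin p ⤖ Fin p

label : ∀ {p} → Labelling p → Fin p → ℕ
label f v = suc (toℕ (Bijection.to f v))

-- Unordered vertex pairs {u,v}, represented as (u,v) with u < v.
pairs : (p : ℕ) → List (Fin p × Fin p)
pairs p = filterᵇ (λ uv → toℕ (proj₁ uv) <ᵇ toℕ (proj₂ uv))
  (concatMap (λ u → map (λ v → (u , v)) (allFin p)) (allFin p))

negEdges : ∀ {p} → Graph p → Labelling p → ℕ
negEdges G f = length (filterᵇ
  (λ uv → adj G (proj₁ uv) (proj₂ uv) ∧
          (isEven (label f (proj₁ uv)) xor isEven (label f (proj₂ uv))))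
  (pairs _))

-- σ⁻(G) = k : k is the minimum over all parity labellings of negEdges.
RnaNumber : ∀ {p} → Graph p → ℕ → Set
RnaNumber {p} G k =
  (Σ (Labelling p) λ f → negEdges G f ≡ k) × (∀ (f : Labelling p) → k ≤ negEdges G f)

module Submission where

-- In the star
-- K_{1,n} every labelling has at least ⌊(n+1)/2⌋ = ⌈n/2⌉ leaves whose parity differs from the centre's,
-- hence as many negative edges, and labelling the centre 1 attains this.
-- A tree without a universal vertex contains a path a b c d. Grow a connected set S from b in
-- T − c, one neighbouring vertex at a time. If S reaches ⌈(n+1)/2⌉ vertices, give S exactly the
-- odd labels: every vertex outside S has at most one neighbour in S (no cycles), so charging each
-- negative edge to its endpoint outside S is injective, and d is never charged; this gives fewer
-- than ⌈n/2⌉ negative edges. Otherwise S gets stuck as the whole component of b in T − bc with at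
-- most ⌊n/2⌋ vertices; symmetrically for c, and the two components would cover only n < n+1 vertices.

open import Defs
open import Data.Nat using (ℕ; suc; _<_; ⌈_/2⌉)
open import Data.Product using (_×_)
open import Function.Bundles using (_⇔_)

open import Data.Bool using (Bool; true; false; not; _xor_; _∧_; T; T?; if_then_else_)
open import Data.Bool.Properties using (not-involutive; xor-comm; xor-same; T-∧; T-≡; T-not-≡; ¬-not)
open import Data.Empty using (⊥-elim)
open import Data.Fin using (Fin; zero; suc; toℕ; inject≤)
import Data.Fin.Properties as Fin
open import Data.Fin.Permutation using (transpose)
open import Data.List
  using (List; []; _∷_; _++_; length; lookup; filter; filterᵇ; allFin; tabulate; map; concatMap; cartesianProduct)
open import Data.List.Properties using (length-tabulate; length-++)
open import Data.List.Membership.Propositional using (_∈_; _∉_; find)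
open import Data.List.Membership.Propositional.Properties
  using (∈-lookup; ∈-allFin; ∈-filter⁺; ∈-filter⁻; ∈-++⁺ˡ; ∈-++⁺ʳ; ∈-cartesianProduct⁺)
open import Data.List.Membership.Setoid.Properties using (index-injective)
open import Data.List.Relation.Binary.Subset.Propositional using (_⊆_)
open import Data.List.Relation.Unary.All as All using (All; []; _∷_)
open import Data.List.Relation.Unary.All.Properties using (¬Any⇒All¬; anti-mono)
open import Data.List.Relation.Unary.Any as Any using (here; there)
open import Data.List.Relation.Unary.Unique.Propositional using (Unique; []; _∷_)
import Data.List.Relation.Unary.Unique.Propositional.Properties as Unique
open import Data.Nat using (zero; _+_; _≤_; ⌊_/2⌋; s≤s; s≤s⁻¹; _<ᵇ_; _<?_)
import Data.Nat.Properties as ℕ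
open import Data.Product using (Σ; ∃; _,_; proj₁; proj₂)
open import Data.Sum using (_⊎_; inj₁; inj₂; [_,_])
open import Function.Base using (_∘_; id)
open import Function.Bundles using (_⤖_; Bijection; mk⤖; mk⇔; Equivalence)
open import Function.Definitions using (Injective)
open import Function.Properties.Inverse using (↔⇒⤖)
open import Relation.Binary.PropositionalEquality
  using (_≡_; _≢_; refl; sym; trans; cong; cong₂; subst; subst₂; setoid)
open import Relation.Nullary using (¬_; Dec; yes; no; does)
open import Relation.Nullary.Decidable using (dec-true; dec-false; ¬?; _×-dec_; _→-dec_; decidable-stable)

-- Counting

module _ {A : Set} where

  lookup-injective : ∀ {xs : List A} → Unique xs → ∀ {i j} → lookup xs i ≡ lookup xs j → i ≡ j
  lookup-injective (_ ∷ _)     {zero}  {zero}  _  = refl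
  lookup-injective (x∉ ∷ _)    {zero}  {suc j} eq = ⊥-elim (All.lookup x∉ (∈-lookup j) eq)
  lookup-injective (x∉ ∷ _)    {suc i} {zero}  eq = ⊥-elim (All.lookup x∉ (∈-lookup i) (sym eq))
  lookup-injective (_ ∷ uxs)   {suc i} {suc j} eq = cong suc (lookup-injective uxs eq)

module _ {A B : Set} where

  length-≤-injection : ∀ (g : A → B) {xs ys} → Unique xs →
    (∀ {a a′} → a ∈ xs → a′ ∈ xs → g a ≡ g a′ → a ≡ a′) →
    (∀ {a} → a ∈ xs → g a ∈ ys) → length xs ≤ length ys
  length-≤-injection g uxs inj img = Fin.injective⇒≤ λ {i} {j} eq →
    lookup-injective uxs (inj (∈-lookup i) (∈-lookup j)
      (index-injective (setoid B) (img (∈-lookup i)) (img (∈-lookup j)) eq))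

  correspondent : ∀ {xs : List A} (ys : List B) → length xs ≤ length ys → ∀ {x} → x ∈ xs → B
  correspondent ys le x∈ = lookup ys (inject≤ (Any.index x∈) le)

  correspondent-∈ : ∀ {xs : List A} (ys : List B) (le : length xs ≤ length ys) {x} (x∈ : x ∈ xs) →
    correspondent ys le x∈ ∈ ys
  correspondent-∈ ys le x∈ = ∈-lookup _

  correspondent-injective : ∀ {xs : List A} {ys : List B} → Unique ys →
    (le : length xs ≤ length ys) → ∀ {x x′} (x∈ : x ∈ xs) (x′∈ : x′ ∈ xs) →
    correspondent ys le x∈ ≡ correspondent ys le x′∈ → x ≡ x′
  correspondent-injective uys le x∈ x′∈ eq = index-injective (setoid A) x∈ x′∈
    (Fin.inject≤-injective le le _ _ (lookup-injective uys eq))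

length-≤-⊆ : ∀ {A : Set} {xs ys : List A} → Unique xs → xs ⊆ ys → length xs ≤ length ys
length-≤-⊆ uxs sub = length-≤-injection id uxs (λ _ _ eq → eq) sub

unique-length-≤ : ∀ {N} {xs : List (Fin N)} → Unique xs → length xs ≤ N
unique-length-≤ {N} {xs} uxs = subst (length xs ≤_) (length-tabulate id) (length-≤-⊆ uxs λ _ → ∈-allFin _)

_∈?_ : ∀ {N} (v : Fin N) (S : List (Fin N)) → Dec (v ∈ S)
v ∈? S = Any.any? (v Fin.≟_) S

count : ∀ {n} → (Fin n → Bool) → ℕ
count {zero}  P = 0
count {suc n} P = (if P zero then 1 else 0) + count (P ∘ suc)

count-cong : ∀ {n} {P Q : Fin n → Bool} → (∀ i → P i ≡ Q i) → count P ≡ count Q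
count-cong {zero}  _  = refl
count-cong {suc n} eq = cong₂ _+_ (cong (λ b → if b then 1 else 0) (eq zero)) (count-cong (eq ∘ suc))

length-filterᵇ-tabulate : ∀ {A : Set} {n} (P : A → Bool) (f : Fin n → A) →
  length (filterᵇ P (tabulate f)) ≡ count (P ∘ f)
length-filterᵇ-tabulate {n = zero}  P f = refl
length-filterᵇ-tabulate {n = suc n} P f with P (f zero)
... | true  = cong suc (length-filterᵇ-tabulate P (f ∘ suc))
... | false = length-filterᵇ-tabulate P (f ∘ suc)

-- isEven (label f v) ≡ evenLabel (Bijection.to f v) holds definitionally.
evenLabel : ∀ {N} → Fin N → Bool
evenLabel i = isEven (suc (toℕ i))

count-evenLabel : ∀ N → count {N} evenLabel ≡ ⌊ N /2⌋
count-oddLabel  : ∀ N → count {N} (not ∘ evenLabel) ≡ ⌈ N /2⌉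

count-evenLabel zero    = refl
count-evenLabel (suc N) = count-oddLabel N
count-oddLabel zero    = refl
count-oddLabel (suc N) =
  cong suc (trans (count-cong {N} (λ i → not-involutive (evenLabel i))) (count-evenLabel N))

length-evenLabels : ∀ N → length (filterᵇ evenLabel (allFin N)) ≡ ⌊ N /2⌋
length-evenLabels N = trans (length-filterᵇ-tabulate {n = N} evenLabel id) (count-evenLabel N)

length-oddLabels : ∀ N → length (filterᵇ (not ∘ evenLabel) (allFin N)) ≡ ⌈ N /2⌉
length-oddLabels N = trans (length-filterᵇ-tabulate {n = N} (not ∘ evenLabel) id) (count-oddLabel N)

⌊/2⌋≤length-parityClass : ∀ N b → ⌊ N /2⌋ ≤ length (filterᵇ (λ i → b xor evenLabel i) (allFin N))
⌊/2⌋≤length-parityClass N false = ℕ.≤-reflexive (sym (length-evenLabels N))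
⌊/2⌋≤length-parityClass N true  = subst (⌊ N /2⌋ ≤_) (sym (length-oddLabels N)) (ℕ.⌊n/2⌋≤⌈n/2⌉ N)

length-disjoint-≤ : ∀ {N} {S xs : List (Fin N)} → Unique S → length S ≡ ⌈ N /2⌉ → Unique xs →
  (∀ {v} → v ∈ xs → v ∉ S) → length xs ≤ ⌊ N /2⌋
length-disjoint-≤ {N} {S} {xs} uS |S|≡ uxs xs∉S = ℕ.+-cancelˡ-≤ ⌈ N /2⌉ (length xs) ⌊ N /2⌋ (begin
  ⌈ N /2⌉ + length xs  ≡⟨ cong (_+ length xs) |S|≡ ⟨
  length S + length xs ≡⟨ length-++ S ⟨
  length (S ++ xs)     ≤⟨ unique-length-≤ (Unique.++⁺ uS uxs λ (v∈S , v∈xs) → xs∉S v∈xs v∈S) ⟩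
  N                    ≡⟨ ℕ.⌊n/2⌋+⌈n/2⌉≡n N ⟨
  ⌊ N /2⌋ + ⌈ N /2⌉    ≡⟨ ℕ.+-comm ⌊ N /2⌋ ⌈ N /2⌉ ⟩
  ⌈ N /2⌉ + ⌊ N /2⌋    ∎)
  where open ℕ.≤-Reasoning

length-filterᵇ-allFin-≤ : ∀ {N} {P Q : Fin N → Bool} (g : Fin N → Fin N) → Injective _≡_ _≡_ g →
  (∀ {i} → T (P i) → T (Q (g i))) → length (filterᵇ P (allFin N)) ≤ length (filterᵇ Q (allFin N))
length-filterᵇ-allFin-≤ {N} {P} {Q} g inj PQ =
  length-≤-injection g (Unique.filter⁺ (T? ∘ P) (Unique.allFin⁺ N)) (λ _ _ → inj)
    λ i∈ → ∈-filter⁺ (T? ∘ Q) (∈-allFin _) (PQ (proj₂ (∈-filter⁻ (T? ∘ P) {xs = allFin N} i∈)))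

-- Labellings

-- A missed value y would let punchOut turn f into an injection Fin (suc N) → Fin N.
injective⇒surjective : ∀ {N} {f : Fin N → Fin N} → Injective _≡_ _≡_ f → ∀ y → ∃ λ x → f x ≡ y
injective⇒surjective {suc N} {f} inj y with Fin.any? (λ x → f x Fin.≟ y)
... | yes hit = hit
... | no miss = ⊥-elim (ℕ.1+n≰n (Fin.injective⇒≤ λ eq →
  inj (Fin.punchOut-injective (λ y≡fx → miss (_ , sym y≡fx)) (λ y≡fx → miss (_ , sym y≡fx)) eq)))

injective⇒⤖ : ∀ {N} (f : Fin N → Fin N) → Injective _≡_ _≡_ f → Fin N ⤖ Fin N
injective⇒⤖ f inj = mk⤖ (inj , λ y → let x , fx≡y = injective⇒surjective inj y in x , λ { refl → fx≡y })

isZero∘injective : ∀ {N} {φ : Fin (suc N) → Fin (suc N)} → Injective _≡_ _≡_ φ →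
  ∀ {c} → φ c ≡ zero → ∀ u → isZero (φ u) ≡ does (u Fin.≟ c)
isZero∘injective {φ = φ} inj {c} φc≡0 u with u Fin.≟ c | φ u in φu≡
... | yes refl | _     = cong isZero (trans (sym φu≡) φc≡0)
... | no u≢c   | zero  = ⊥-elim (u≢c (inj (trans φu≡ (sym φc≡0))))
... | no _     | suc _ = refl

centreFirst : ∀ {N} → Fin (suc N) → Labelling (suc N)
centreFirst c = ↔⇒⤖ (transpose c zero)

centreFirst-centre : ∀ {N} (c : Fin (suc N)) → Bijection.to (centreFirst c) c ≡ zero
centreFirst-centre c rewrite dec-true (c Fin.≟ c) refl = refl

oddLabelsOn : ∀ {N} {S : List (Fin N)} → Unique S → length S ≡ ⌈ N /2⌉ →
  Σ (Labelling N) λ f → ∀ v → (v ∈ S → evenLabel (Bijection.to f v) ≡ false)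
                             × (v ∉ S → evenLabel (Bijection.to f v) ≡ true)
oddLabelsOn {N} {S} uS |S|≡ = injective⇒⤖ assign injective , parity
  where
  O E R : List (Fin N)
  O = filterᵇ (not ∘ evenLabel) (allFin N)
  E = filterᵇ evenLabel (allFin N)
  R = filter (λ v → ¬? (v ∈? S)) (allFin N)

  ∈R : ∀ {v} → v ∉ S → v ∈ R
  ∈R v∉S = ∈-filter⁺ (λ v → ¬? (v ∈? S)) (∈-allFin _) v∉S

  ∈R⁻ : ∀ {v} → v ∈ R → v ∉ S
  ∈R⁻ v∈R = proj₂ (∈-filter⁻ (λ v → ¬? (v ∈? S)) {xs = allFin N} v∈R)

  uO : Unique O
  uO = Unique.filter⁺ _ (Unique.allFin⁺ N)

  uE : Unique E
  uE = Unique.filter⁺ _ (Unique.allFin⁺ N)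

  uR : Unique R
  uR = Unique.filter⁺ _ (Unique.allFin⁺ N)

  ∈O⇒ : ∀ {i} → i ∈ O → evenLabel i ≡ false
  ∈O⇒ i∈ = Equivalence.to T-not-≡ (proj₂ (∈-filter⁻ (T? ∘ not ∘ evenLabel) {xs = allFin N} i∈))

  ∈E⇒ : ∀ {i} → i ∈ E → evenLabel i ≡ true
  ∈E⇒ i∈ = Equivalence.to T-≡ (proj₂ (∈-filter⁻ (T? ∘ evenLabel) {xs = allFin N} i∈))

  O∩E : ∀ {i j} → i ∈ O → j ∈ E → i ≢ j
  O∩E i∈O j∈E refl with trans (sym (∈O⇒ i∈O)) (∈E⇒ j∈E)
  ... | ()

  S≤O : length S ≤ length O
  S≤O = ℕ.≤-reflexive (trans |S|≡ (sym (length-oddLabels N)))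

  R≤E : length R ≤ length E
  R≤E = subst (length R ≤_) (sym (length-evenLabels N)) (length-disjoint-≤ uS |S|≡ uR ∈R⁻)

  assignBy : ∀ v → Dec (v ∈ S) → Fin N
  assignBy v (yes v∈S) = correspondent O S≤O v∈S
  assignBy v (no v∉S)  = correspondent E R≤E (∈R v∉S)

  assign : Fin N → Fin N
  assign v = assignBy v (v ∈? S)

  injective : Injective _≡_ _≡_ assign
  injective {x} {y} eq with x ∈? S | y ∈? S
  ... | yes x∈ | yes y∈ = correspondent-injective uO S≤O x∈ y∈ eq
  ... | no x∉  | no y∉  = correspondent-injective uE R≤E (∈R x∉) (∈R y∉) eq
  ... | yes x∈ | no y∉  = ⊥-elim (O∩E (correspondent-∈ O S≤O x∈) (correspondent-∈ E R≤E (∈R y∉)) eq)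
  ... | no x∉  | yes y∈ = ⊥-elim (O∩E (correspondent-∈ O S≤O y∈) (correspondent-∈ E R≤E (∈R x∉)) (sym eq))

  parity : ∀ v → (v ∈ S → evenLabel (assign v) ≡ false) × (v ∉ S → evenLabel (assign v) ≡ true)
  parity v with v ∈? S
  ... | yes v∈S = (λ _ → ∈O⇒ (correspondent-∈ O S≤O v∈S)) , λ v∉S → ⊥-elim (v∉S v∈S)
  ... | no v∉S  = (λ v∈S → ⊥-elim (v∉S v∈S)) , λ _ → ∈E⇒ (correspondent-∈ E R≤E (∈R v∉S))

-- Unordered pairs

concatMap-pairs : ∀ {A B : Set} (xs : List A) (ys : List B) →
  concatMap (λ u → map (λ v → (u , v)) ys) xs ≡ cartesianProduct xs ys
concatMap-pairs []       ys = refl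
concatMap-pairs (x ∷ xs) ys = cong (map (x ,_) ys ++_) (concatMap-pairs xs ys)

module _ {N : ℕ} where

  private
    ordered : Fin N × Fin N → Bool
    ordered uv = toℕ (proj₁ uv) <ᵇ toℕ (proj₂ uv)

    allFin² : List (Fin N × Fin N)
    allFin² = concatMap (λ u → map (λ v → (u , v)) (allFin N)) (allFin N)

  pairs-unique : Unique (pairs N)
  pairs-unique = Unique.filter⁺ (T? ∘ ordered)
    (subst Unique (sym (concatMap-pairs (allFin N) _))
      (Unique.cartesianProduct⁺ (Unique.allFin⁺ N) (Unique.allFin⁺ N)))

  ∈-pairs⁺ : ∀ {u v} → toℕ u < toℕ v → (u , v) ∈ pairs N
  ∈-pairs⁺ u<v = ∈-filter⁺ (T? ∘ ordered)
    (subst (_ ∈_) (sym (concatMap-pairs (allFin N) _)) (∈-cartesianProduct⁺ (∈-allFin _) (∈-allFin _)))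
    (ℕ.<⇒<ᵇ u<v)

  ∈-pairs⁻ : ∀ {u v} → (u , v) ∈ pairs N → toℕ u < toℕ v
  ∈-pairs⁻ uv∈ = ℕ.<ᵇ⇒< _ _ (proj₂ (∈-filter⁻ (T? ∘ ordered) {xs = allFin²} uv∈))

  pairs-swap : ∀ {u v} → (u , v) ∈ pairs N → (v , u) ∉ pairs N
  pairs-swap uv∈ vu∈ = ℕ.<-asym (∈-pairs⁻ uv∈) (∈-pairs⁻ vu∈)

  Ends : Fin N × Fin N → Fin N → Fin N → Set
  Ends uv a b = uv ≡ (a , b) ⊎ uv ≡ (b , a)

  pairs-≡ : ∀ {uv uv′ a b} → uv ∈ pairs N → uv′ ∈ pairs N → Ends uv a b → Ends uv′ a b → uv ≡ uv′
  pairs-≡ _  _   (inj₁ refl) (inj₁ refl) = refl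
  pairs-≡ _  _   (inj₂ refl) (inj₂ refl) = refl
  pairs-≡ p p′ (inj₁ refl) (inj₂ refl) = ⊥-elim (pairs-swap p p′)
  pairs-≡ p p′ (inj₂ refl) (inj₁ refl) = ⊥-elim (pairs-swap p p′)

  Ends-injectiveʳ : ∀ {uv c w w′} → Ends uv c w → Ends uv c w′ → w ≡ w′
  Ends-injectiveʳ (inj₁ refl) (inj₁ refl) = refl
  Ends-injectiveʳ (inj₁ refl) (inj₂ refl) = refl
  Ends-injectiveʳ (inj₂ refl) (inj₁ refl) = refl
  Ends-injectiveʳ (inj₂ refl) (inj₂ refl) = refl

  sortPair : Fin N → Fin N → Fin N × Fin N
  sortPair u v with toℕ u <? toℕ v
  ... | yes _ = u , v
  ... | no _  = v , u

  sortPair-ends : ∀ u v → Ends (sortPair u v) u v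
  sortPair-ends u v with toℕ u <? toℕ v
  ... | yes _ = inj₁ refl
  ... | no _  = inj₂ refl

  sortPair-∈-pairs : ∀ {u v} → u ≢ v → sortPair u v ∈ pairs N
  sortPair-∈-pairs {u} {v} u≢v with toℕ u <? toℕ v
  ... | yes u<v = ∈-pairs⁺ u<v
  ... | no u≮v  = ∈-pairs⁺ (ℕ.≤∧≢⇒< (ℕ.≮⇒≥ u≮v) (λ eq → u≢v (Fin.toℕ-injective (sym eq))))

  sortPair-injectiveʳ : ∀ c {w w′} → sortPair c w ≡ sortPair c w′ → w ≡ w′
  sortPair-injectiveʳ c {w} {w′} eq =
    Ends-injectiveʳ (sortPair-ends c w) (subst (λ uv → Ends uv c w′) (sym eq) (sortPair-ends c w′))

-- Walks, paths and cycles

module _ {N : ℕ} (G : Graph N) where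

  Adj : Fin N → Fin N → Set
  Adj u v = T (adj G u v)

  Adj-sym : ∀ {u v} → Adj u v → Adj v u
  Adj-sym {u} {v} = subst T (symm G u v)

  Adj-irrefl : ∀ {u v} → Adj u v → u ≢ v
  Adj-irrefl {u} a refl = subst T (irrefl G u) a

  later : ∀ {u v} → Walk G u v → List (Fin N)
  later here                = []
  later (step {w = w} _ r) = w ∷ later r

  verts : ∀ {u v} → Walk G u v → List (Fin N)
  verts {u} r = u ∷ later r

  _++w_ : ∀ {u v w} → Walk G u v → Walk G v w → Walk G u w
  here     ++w s = s
  step e r ++w s = step e (r ++w s)

  reverse : ∀ {u v} → Walk G u v → Walk G v u
  reverse here       = here
  reverse (step e r) = reverse r ++w step (Adj-sym e) here

  module _ {P : Fin N → Set} where

    All-++w : ∀ {u v w} (r : Walk G u v) (s : Walk G v w) →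
      All P (verts r) → All P (verts s) → All P (verts (r ++w s))
    All-++w here       s _          Ps = Ps
    All-++w (step e r) s (Pu ∷ Pr) Ps = Pu ∷ All-++w r s Pr Ps

    All-reverse : ∀ {u v} (r : Walk G u v) → All P (verts r) → All P (verts (reverse r))
    All-reverse here       Pr                   = Pr
    All-reverse (step e r) (Pu ∷ Pr@(Pw ∷ _)) = All-++w (reverse r) _ (All-reverse r Pr) (Pw ∷ Pu ∷ [])

  suffix : ∀ {u v a} (r : Walk G u v) → a ∈ verts r → Unique (verts r) →
    Σ (Walk G a v) λ s → Unique (verts s) × verts s ⊆ verts r
  suffix r          (here refl) ur       = r , ur , id
  suffix (step e r) (there a∈)  (_ ∷ ur) with suffix r a∈ ur
  ... | s , us , s⊆r = s , us , there ∘ s⊆r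

  toPath : ∀ {u v} (r : Walk G u v) → Σ (Walk G u v) λ p → Unique (verts p) × verts p ⊆ verts r
  toPath here = here , [] ∷ [] , id
  toPath (step {u} e r) with toPath r
  ... | p , up , p⊆r with u ∈? verts p
  ...   | yes u∈p = let s , us , s⊆p = suffix p u∈p up in s , us , there ∘ p⊆r ∘ s⊆p
  ...   | no u∉p  = step e p , ¬Any⇒All¬ _ u∉p ∷ up ,
                    λ { (here refl) → here refl ; (there x∈) → there (p⊆r x∈) }

  -- Along q followed by the edge z w, read with w in place of the first vertex of q, each vertex is
  -- adjacent to its successor in the order of nextIdx.
  walk-cyclic-adj : ∀ {w u z} (q : Walk G u z) → Adj z w →
    ∀ i → Adj (lookup (verts q) i) (lookup (w ∷ later q) (nextIdx i))
  walk-cyclic-adj here       zw zero    = zw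
  walk-cyclic-adj (step e q) zw zero    = e
  walk-cyclic-adj (step e q) zw (suc i) with nextIdx i | walk-cyclic-adj q zw i
  ... | zero  | ih = ih
  ... | suc _ | ih = ih

  cycle-through : ∀ {x y z} (r : Walk G y z) → All (_≢ x) (verts r) → y ≢ z → Adj x y → Adj z x → Cycle G
  cycle-through r r≢x y≢z xy zx with toPath r
  ... | here , _ , _ = ⊥-elim (y≢z refl)
  ... | p@(step _ p′) , up , p⊆r =
    length (later p′) , lookup (verts q) , lookup-injective uq , walk-cyclic-adj q zx
    where
    q : Walk G _ _
    q = step xy p

    uq : Unique (verts q)
    uq = All.map (λ v≢x x≡v → v≢x (sym x≡v)) (anti-mono p⊆r r≢x) ∷ up

  Rooted : List (Fin N) → Fin N → Set
  Rooted S s = ∀ {a} → a ∈ S → Σ (Walk G a s) λ r → All (_∈ S) (verts r)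

  rooted-[] : ∀ s → Rooted (s ∷ []) s
  rooted-[] s (here refl) = here , here refl ∷ []

  rooted-∷ : ∀ {S s y v} → Rooted S s → y ∈ S → Adj y v → Rooted (v ∷ S) s
  rooted-∷ rt y∈ yv (here refl) = let r , r⊆S = rt y∈ in step (Adj-sym yv) r , here refl ∷ All.map there r⊆S
  rooted-∷ rt y∈ yv (there a∈)  = let r , r⊆S = rt a∈ in r , All.map there r⊆S

  walkWithin : ∀ {S s a b} → Rooted S s → a ∈ S → b ∈ S → Σ (Walk G a b) λ r → All (_∈ S) (verts r)
  walkWithin rt a∈ b∈ =
    let ra , ra⊆S = rt a∈
        rb , rb⊆S = rt b∈
    in ra ++w reverse rb , All-++w ra (reverse rb) ra⊆S (All-reverse rb rb⊆S)

  acyclic⇒unique-neighbour : Acyclic G → ∀ {S s x t t′} → Rooted S s → x ∉ S →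
    t ∈ S → t′ ∈ S → Adj x t → Adj x t′ → t ≡ t′
  acyclic⇒unique-neighbour acyclic {S} {t = t} {t′} rt x∉S t∈ t′∈ xt xt′ with t Fin.≟ t′
  ... | yes t≡t′ = t≡t′
  ... | no t≢t′ with walkWithin rt t∈ t′∈
  ...   | r , r⊆S = ⊥-elim (acyclic (cycle-through r r≢x t≢t′ xt (Adj-sym xt′)))
    where
    r≢x : All (_≢ _) (verts r)
    r≢x = All.map (λ v∈S v≡x → x∉S (subst (_∈ S) v≡x v∈S)) r⊆S

  -- Negative edges

  module _ (f : Labelling N) where
    open Bijection f using (to)

    negative : Fin N → Fin N → Bool
    negative u v = adj G u v ∧ (evenLabel (to u) xor evenLabel (to v))

    negativeEdges : List (Fin N × Fin N)
    negativeEdges = filterᵇ (λ uv → negative (proj₁ uv) (proj₂ uv)) (pairs N)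

    negative-comm : ∀ u v → negative u v ≡ negative v u
    negative-comm u v = cong₂ _∧_ (symm G u v) (xor-comm (evenLabel (to u)) _)

    negative⇒Adj : ∀ {u v} → T (negative u v) → Adj u v
    negative⇒Adj neg = proj₁ (Equivalence.to T-∧ neg)

    negative⇒evenLabel-≢ : ∀ {u v} → T (negative u v) → evenLabel (to u) ≢ evenLabel (to v)
    negative⇒evenLabel-≢ {u} neg same =
      subst T (trans (cong (evenLabel (to u) xor_) (sym same)) (xor-same (evenLabel (to u))))
        (proj₂ (Equivalence.to T-∧ neg))

    ∈-negativeEdges⁻ : ∀ {uv} → uv ∈ negativeEdges → uv ∈ pairs N × T (negative (proj₁ uv) (proj₂ uv))
    ∈-negativeEdges⁻ = ∈-filter⁻ (T? ∘ λ uv → negative (proj₁ uv) (proj₂ uv))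

    length-≤-negEdges : ∀ c {ws} → Unique ws → (∀ {w} → w ∈ ws → T (negative c w)) →
      length ws ≤ negEdges G f
    length-≤-negEdges c uws neg =
      length-≤-injection (sortPair c) uws (λ _ _ → sortPair-injectiveʳ c) λ {w} w∈ →
        ∈-filter⁺ (T? ∘ λ uv → negative (proj₁ uv) (proj₂ uv))
          (sortPair-∈-pairs (Adj-irrefl (negative⇒Adj (neg w∈))))
          (negative-ends (sortPair-ends c w) (neg w∈))
      where
      negative-ends : ∀ {c w uv} → Ends uv c w → T (negative c w) → T (negative (proj₁ uv) (proj₂ uv))
      negative-ends (inj₁ refl) n = n
      negative-ends {c} {w} (inj₂ refl) n = subst T (negative-comm c w) n

    -- Each negative edge is charged to its endpoint outside S.
    negEdges-≤-crossing : ∀ (S ys : List (Fin N)) →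
      (∀ {u v} → T (negative u v) → u ∉ S → v ∈ S) →
      (∀ {u v} → T (negative u v) → u ∈ S → v ∉ S) →
      (∀ {v t t′} → v ∉ S → t ∈ S → t′ ∈ S → Adj v t → Adj v t′ → t ≡ t′) →
      (∀ {t v} → t ∈ S → v ∉ S → T (negative t v) → v ∈ ys) →
      negEdges G f ≤ length ys
    negEdges-≤-crossing S ys inward outward unique-inner charged =
      length-≤-injection outer (Unique.filter⁺ _ pairs-unique) injective λ uv∈ →
        let _ , t∈ , o∉ , neg , _ = outer-spec (proj₂ (∈-negativeEdges⁻ uv∈)) in charged t∈ o∉ neg
      where
      outer : Fin N × Fin N → Fin N
      outer (u , v) with u ∈? S
      ... | yes _ = v
      ... | no _  = u

      outer-spec : ∀ {u v} → T (negative u v) →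
        Σ (Fin N) λ t → t ∈ S × outer (u , v) ∉ S × T (negative t (outer (u , v)))
                      × Ends (u , v) t (outer (u , v))
      outer-spec {u} {v} neg with u ∈? S
      ... | yes u∈ = u , u∈ , outward neg u∈ , neg , inj₁ refl
      ... | no u∉  = v , inward neg u∉ , u∉ , subst T (negative-comm u v) neg , inj₂ refl

      injective : ∀ {uv uv′} → uv ∈ negativeEdges → uv′ ∈ negativeEdges → outer uv ≡ outer uv′ → uv ≡ uv′
      injective {uv} {uv′} uv∈ uv′∈ o≡o′
        with ∈-negativeEdges⁻ uv∈ | ∈-negativeEdges⁻ uv′∈
      ... | p , neg | p′ , neg′
        with outer-spec neg | outer-spec neg′
      ... | t , t∈ , o∉ , nt , ends | t′ , t′∈ , _ , nt′ , ends′
        with unique-inner o∉ t∈ t′∈ (Adj-sym (negative⇒Adj nt))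
               (subst (λ o → Adj o t′) (sym o≡o′) (Adj-sym (negative⇒Adj nt′)))
      ... | refl = pairs-≡ p p′ ends (subst (Ends uv′ t) (sym o≡o′) ends′)

  -- Stars

  StarCentre : Fin N → Set
  StarCentre c = ∀ u v → adj G u v ≡ does (u Fin.≟ c) xor does (v Fin.≟ c)

  module _ {c} (centre : StarCentre c) where

    StarCentre-adj : ∀ {w} → w ≢ c → Adj c w
    StarCentre-adj {w} w≢c = subst T (sym (trans (centre c w)
      (cong₂ _xor_ (dec-true (c Fin.≟ c) refl) (dec-false (w Fin.≟ c) w≢c)))) _

    StarCentre-edge : ∀ {u v} → Adj u v → u ≡ c ⊎ v ≡ c
    StarCentre-edge {u} {v} uv with u Fin.≟ c | v Fin.≟ c
    ... | yes u≡c | _       = inj₁ u≡c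
    ... | no _    | yes v≡c = inj₂ v≡c
    ... | no u≢c  | no v≢c  = ⊥-elim (subst T (trans (centre u v)
      (cong₂ _xor_ (dec-false (u Fin.≟ c) u≢c) (dec-false (v Fin.≟ c) v≢c))) uv)

    StarCentre-negEdges-≥ : ∀ f → ⌊ N /2⌋ ≤ negEdges G f
    StarCentre-negEdges-≥ f =
      ℕ.≤-trans (⌊/2⌋≤length-parityClass N b) (ℕ.≤-trans oppositeLabels≤ oppositeVertices≤)
      where
      open Bijection f using (to; injective; surjective)
      b : Bool
      b = evenLabel (to c)

      opposite : Fin N → Bool
      opposite w = b xor evenLabel (to w)

      from : Fin N → Fin N
      from i = proj₁ (surjective i)

      to∘from : ∀ i → to (from i) ≡ i
      to∘from i = proj₂ (surjective i) refl

      oppositeLabels≤ :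
        length (filterᵇ (λ i → b xor evenLabel i) (allFin N)) ≤ length (filterᵇ opposite (allFin N))
      oppositeLabels≤ = length-filterᵇ-allFin-≤ from
        (λ {i} {j} eq → trans (sym (to∘from i)) (trans (cong to eq) (to∘from j)))
        (λ {i} → subst (λ j → T (b xor evenLabel j)) (sym (to∘from i)))

      oppositeVertices≤ : length (filterᵇ opposite (allFin N)) ≤ negEdges G f
      oppositeVertices≤ = length-≤-negEdges f c (Unique.filter⁺ (T? ∘ opposite) (Unique.allFin⁺ N)) λ {w} w∈ →
        let opp = proj₂ (∈-filter⁻ (T? ∘ opposite) {xs = allFin N} w∈)
            w≢c = λ { refl → subst T (xor-same b) opp }
        in Equivalence.from T-∧ (StarCentre-adj w≢c , opp)

  Universal : Fin N → Set
  Universal c = ∀ w → w ≢ c → Adj c w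

  universal? : ∀ c → Dec (Universal c)
  universal? c = Fin.all? λ w → ¬? (w Fin.≟ c) →-dec T? (adj G c w)

  nonNeighbour : ∀ {v} → ¬ Universal v → Σ (Fin N) λ w → w ≢ v × ¬ Adj v w
  nonNeighbour {v} ¬univ with Fin.¬∀⟶∃¬ N _ (λ w → ¬? (w Fin.≟ v) →-dec T? (adj G v w)) ¬univ
  ... | w , ¬w = w , (λ w≡v → ¬w λ w≢v → ⊥-elim (w≢v w≡v)) , λ vw → ¬w λ _ → vw

  universal⇒StarCentre : Acyclic G → ∀ {c} → Universal c → StarCentre c
  universal⇒StarCentre acyclic {c} universal u v with u Fin.≟ c | v Fin.≟ c
  ... | yes refl | yes refl = irrefl G c
  ... | yes refl | no v≢c   = Equivalence.to T-≡ (universal v v≢c)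
  ... | no u≢c   | yes refl = Equivalence.to T-≡ (Adj-sym (universal u u≢c))
  ... | no u≢c   | no v≢c   = ¬-not λ uv≡true →
    let uv = Equivalence.from T-≡ uv≡true in Adj-irrefl uv (triangle uv)
    where
    triangle : Adj u v → u ≡ v
    triangle uv = acyclic⇒unique-neighbour acyclic (rooted-∷ (rooted-[] u) (here refl) uv)
      (λ { (here c≡v) → v≢c (sym c≡v) ; (there (here c≡u)) → u≢c (sym c≡u) })
      (there (here refl)) (here refl) (universal u u≢c) (universal v v≢c)

module _ {n : ℕ} (G : Graph (suc n)) where

  Isomorphic⇒StarCentre : Isomorphic G (star n) → Σ (Fin (suc n)) (StarCentre G)
  Isomorphic⇒StarCentre (φ , φ-iso) = c , λ u v →
    trans (φ-iso u v) (cong₂ _xor_ (isZero∘injective injective φc≡0 u) (isZero∘injective injective φc≡0 v))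
    where
    open Bijection φ using (to; injective; surjective)
    c : Fin (suc n)
    c = proj₁ (surjective zero)

    φc≡0 : to c ≡ zero
    φc≡0 = proj₂ (surjective zero) refl

  StarCentre⇒Isomorphic : ∀ {c} → StarCentre G c → Isomorphic G (star n)
  StarCentre⇒Isomorphic {c} centre = centreFirst c , λ u v →
    trans (centre u v) (sym (cong₂ _xor_ (isZero∘injective injective (centreFirst-centre c) u)
                                         (isZero∘injective injective (centreFirst-centre c) v)))
    where open Bijection (centreFirst c) using (injective)

  StarCentre⇒rna : ∀ {c} → StarCentre G c → RnaNumber G ⌈ n /2⌉
  StarCentre⇒rna {c} centre = (φ , ℕ.≤-antisym negEdges-φ≤ (StarCentre-negEdges-≥ G centre φ)) ,
                               StarCentre-negEdges-≥ G centre
    where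
    φ : Labelling (suc n)
    φ = centreFirst c
    open Bijection φ using (to; injective)

    evenVertices : List (Fin (suc n))
    evenVertices = filterᵇ (evenLabel ∘ to) (allFin (suc n))

    evenVertices≤ : length evenVertices ≤ ⌈ n /2⌉
    evenVertices≤ = subst (length evenVertices ≤_) (length-evenLabels (suc n))
      (length-filterᵇ-allFin-≤ {P = evenLabel ∘ to} {Q = evenLabel} to injective id)

    inward : ∀ {u v} → T (negative G φ u v) → u ∉ c ∷ [] → v ∈ c ∷ []
    inward neg u∉ with StarCentre-edge G centre (negative⇒Adj G φ neg)
    ... | inj₁ u≡c = ⊥-elim (u∉ (here u≡c))
    ... | inj₂ v≡c = here v≡c

    outward : ∀ {u v} → T (negative G φ u v) → u ∈ c ∷ [] → v ∉ c ∷ []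
    outward neg (here refl) (here refl) = Adj-irrefl G (negative⇒Adj G φ neg) refl

    charged : ∀ {t v} → t ∈ c ∷ [] → v ∉ c ∷ [] → T (negative G φ t v) → v ∈ evenVertices
    charged {v = v} (here refl) _ neg = ∈-filter⁺ (T? ∘ evenLabel ∘ to) (∈-allFin _)
      (subst (λ i → T (evenLabel i xor evenLabel (to v))) (centreFirst-centre c) (proj₂ (Equivalence.to T-∧ neg)))

    negEdges-φ≤ : negEdges G φ ≤ ⌈ n /2⌉
    negEdges-φ≤ = ℕ.≤-trans (negEdges-≤-crossing G φ (c ∷ []) evenVertices inward outward
      (λ { _ (here refl) (here refl) _ _ → refl }) charged) evenVertices≤

-- Trees that are not stars

module _ {N : ℕ} (G : Graph N) where

  fewNegativeEdges : Acyclic G → ∀ {S s d} → Unique S → Rooted G S s → length S ≡ ⌈ N /2⌉ →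
    d ∉ S → (∀ {t} → t ∈ S → ¬ Adj G t d) → Σ (Labelling N) λ f → negEdges G f < ⌊ N /2⌋
  fewNegativeEdges acyclic {S} {s} {d} uS rooted |S|≡ d∉S d-far with oddLabelsOn uS |S|≡
  ... | f , parity = f , ℕ.≤-trans (s≤s negEdges≤) |ys|<
    where
    outside : Fin N → Set
    outside v = v ∉ S × v ≢ d
    outside? : ∀ v → Dec (outside v)
    outside? v = ¬? (v ∈? S) ×-dec ¬? (v Fin.≟ d)

    ys : List (Fin N)
    ys = filter outside? (allFin N)

    inward : ∀ {u v} → T (negative G f u v) → u ∉ S → v ∈ S
    inward {u} {v} neg u∉S = decidable-stable (v ∈? S) λ v∉S →
      negative⇒evenLabel-≢ G f neg (trans (proj₂ (parity u) u∉S) (sym (proj₂ (parity v) v∉S)))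

    outward : ∀ {u v} → T (negative G f u v) → u ∈ S → v ∉ S
    outward {u} {v} neg u∈S v∈S =
      negative⇒evenLabel-≢ G f neg (trans (proj₁ (parity u) u∈S) (sym (proj₁ (parity v) v∈S)))

    charged : ∀ {t v} → t ∈ S → v ∉ S → T (negative G f t v) → v ∈ ys
    charged t∈S v∉S neg = ∈-filter⁺ outside? (∈-allFin _) (v∉S , λ { refl → d-far t∈S (negative⇒Adj G f neg) })

    negEdges≤ : negEdges G f ≤ length ys
    negEdges≤ = negEdges-≤-crossing G f S ys inward outward
      (acyclic⇒unique-neighbour G acyclic rooted) charged

    |ys|< : suc (length ys) ≤ ⌊ N /2⌋
    |ys|< = length-disjoint-≤ uS |S|≡ (d∉ys ∷ Unique.filter⁺ outside? (Unique.allFin⁺ N))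
      λ { (here refl) → d∉S ; (there v∈ys) → proj₁ (proj₂ (∈-filter⁻ outside? {xs = allFin N} v∈ys)) }
      where
      d∉ys : All (d ≢_) ys
      d∉ys = All.tabulate λ v∈ys d≡v → proj₂ (proj₂ (∈-filter⁻ outside? {xs = allFin N} v∈ys)) (sym d≡v)

  record Branch (s x : Fin N) : Set where
    field
      members   : List (Fin N)
      unique    : Unique members
      root∈     : s ∈ members
      excluded  : x ∉ members
      rooted    : Rooted G members s
  open Branch

  -- For an edge s x of a tree, the members of a closed branch form the component of s in G − sx.
  Closed : ∀ {s x} → Branch s x → Set
  Closed {x = x} B = ∀ {y v} → y ∈ members B → Adj G y v → v ≢ x → v ∈ members B

  singleton : ∀ {s x} → x ≢ s → Branch s x
  singleton {s} x≢s = record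
    { members = s ∷ [] ; unique = [] ∷ [] ; root∈ = here refl
    ; excluded = λ { (here x≡s) → x≢s x≡s } ; rooted = rooted-[] G s }

  extend : ∀ {s x v y} (B : Branch s x) → v ∉ members B → v ≢ x → y ∈ members B → Adj G y v → Branch s x
  extend B v∉B v≢x y∈B yv = record
    { members = _ ∷ members B ; unique = ¬Any⇒All¬ _ v∉B ∷ unique B ; root∈ = there (root∈ B)
    ; excluded = λ { (here x≡v) → v≢x (sym x≡v) ; (there x∈B) → excluded B x∈B }
    ; rooted = rooted-∷ G (rooted B) y∈B yv }

  grow : ∀ {s x} k (B : Branch s x) → Σ (Branch s x) λ B′ →
    length (members B′) ≡ k + length (members B) ⊎ (Closed B′ × length (members B′) < k + length (members B))
  grow zero B = B , inj₁ refl
  grow {x = x} (suc k) B with Fin.any? (λ v → ¬? (v ∈? members B) ×-dec ¬? (v Fin.≟ x)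
                                                ×-dec Any.any? (λ y → T? (adj G y v)) (members B))
  ... | yes (v , v∉B , v≢x , has-neighbour) with find has-neighbour
  ...   | y , y∈B , yv with grow k (extend B v∉B v≢x y∈B yv)
  ...     | B′ , inj₁ |B′|≡         = B′ , inj₁ (trans |B′|≡ (ℕ.+-suc k _))
  ...     | B′ , inj₂ (closed , |B′|<) =
    B′ , inj₂ (closed , subst (length (members B′) <_) (ℕ.+-suc k _) |B′|<)
  grow (suc k) B | no stuck = B , inj₂ (closed , s≤s (ℕ.m≤n+m _ k))
    where
    closed : Closed B
    closed {y} {v} y∈B yv v≢x = decidable-stable (v ∈? members B) λ v∉B →
      stuck (v , v∉B , v≢x , Any.map (λ { refl → yv }) y∈B)

module _ {n : ℕ} (G : Graph (suc n)) (connected : Connected G) (acyclic : Acyclic G) where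
  open Branch

  bigBranch⇒fewNegativeEdges : ∀ {b c d} (B : Branch G b c) → length (members B) ≡ ⌈ suc n /2⌉ →
    Adj G b c → Adj G c d → d ≢ b → Σ (Labelling (suc n)) λ f → negEdges G f < ⌈ n /2⌉
  bigBranch⇒fewNegativeEdges {b} {c} {d} B |B|≡ bc cd d≢b =
    fewNegativeEdges G acyclic (unique B) (rooted B) |B|≡ d∉B d-far
    where
    d∉connected : ∀ {S} → Rooted G S b → c ∉ S → b ∈ S → d ∉ S
    d∉connected rt c∉S b∈S d∈S =
      d≢b (sym (acyclic⇒unique-neighbour G acyclic rt c∉S b∈S d∈S (Adj-sym G bc) cd))

    d∉B : d ∉ members B
    d∉B = d∉connected (rooted B) (excluded B) (root∈ B)

    d-far : ∀ {t} → t ∈ members B → ¬ Adj G t d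
    d-far t∈B td = d∉connected (rooted-∷ G (rooted B) t∈B td)
      (λ { (here c≡d) → Adj-irrefl G cd c≡d ; (there c∈B) → excluded B c∈B }) (there (root∈ B)) (here refl)

  branch-dichotomy : ∀ {b c d} → Adj G b c → Adj G c d → d ≢ b →
    (Σ (Labelling (suc n)) λ f → negEdges G f < ⌈ n /2⌉) ⊎
    (Σ (Branch G b c) λ B → Closed G B × length (members B) ≤ ⌊ n /2⌋)
  branch-dichotomy bc cd d≢b with grow G ⌊ n /2⌋ (singleton G (Adj-irrefl G bc ∘ sym))
  ... | B , inj₁ |B|≡ =
    inj₁ (bigBranch⇒fewNegativeEdges B (trans |B|≡ (ℕ.+-comm ⌊ n /2⌋ 1)) bc cd d≢b)
  ... | B , inj₂ (closed , |B|<) =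
    inj₂ (B , closed , s≤s⁻¹ (subst (length (members B) <_) (ℕ.+-comm ⌊ n /2⌋ 1) |B|<))

  closedBranches-cover : ∀ {b c} → Adj G b c → (B : Branch G b c) → Closed G B →
    (C : Branch G c b) → Closed G C → ∀ v → v ∈ members B ⊎ v ∈ members C
  closedBranches-cover {b} {c} bc B closedB C closedC v = along (connected b v) (inj₁ (root∈ B))
    where
    along : ∀ {u v} → Walk G u v → u ∈ members B ⊎ u ∈ members C → v ∈ members B ⊎ v ∈ members C
    along here                  u∈ = u∈
    along (step {w = w} uw r) (inj₁ u∈B) with w Fin.≟ c
    ... | yes refl = along r (inj₂ (root∈ C))
    ... | no w≢c   = along r (inj₁ (closedB u∈B uw w≢c))
    along (step {w = w} uw r) (inj₂ u∈C) with w Fin.≟ b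
    ... | yes refl = along r (inj₁ (root∈ B))
    ... | no w≢b   = along r (inj₂ (closedC u∈C uw w≢b))

  record Path₄ : Set where
    field
      {a b c d} : Fin (suc n)
      ab  : Adj G a b
      bc  : Adj G b c
      cd  : Adj G c d
      a≢c : a ≢ c
      b≢d : b ≢ d

  nonUniversal⇒path₃ : ∀ {v} → ¬ Universal G v →
    Σ (Fin (suc n)) λ p → Σ (Fin (suc n)) λ q → Adj G v p × Adj G p q × v ≢ q
  nonUniversal⇒path₃ {v} ¬univ with nonNeighbour G ¬univ
  ... | w , w≢v , ¬vw with toPath G (connected v w)
  ...   | here                , _          , _ = ⊥-elim (w≢v refl)
  ...   | step vw here        , _          , _ = ⊥-elim (¬vw vw)
  ...   | step vp (step pq _) , (v∉ ∷ _) , _ = _ , _ , vp , pq , All.lookup v∉ (there (here refl))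

  noUniversal⇒Path₄ : (∀ v → ¬ Universal G v) → Path₄
  noUniversal⇒Path₄ none with nonUniversal⇒path₃ (none zero)
  ... | p , q , 0p , pq , 0≢q with nonUniversal⇒path₃ (none p)
  ...   | p′ , q′ , pp′ , p′q′ , p≢q′ with p′ Fin.≟ zero
  ...     | yes refl = record { ab = Adj-sym G pq ; bc = pp′ ; cd = p′q′ ; a≢c = 0≢q ∘ sym ; b≢d = p≢q′ }
  ...     | no p′≢0  = record { ab = 0p ; bc = pp′ ; cd = p′q′ ; a≢c = p′≢0 ∘ sym ; b≢d = p≢q′ }

  noUniversal⇒fewNegativeEdges : (∀ v → ¬ Universal G v) → Σ (Labelling (suc n)) λ f → negEdges G f < ⌈ n /2⌉
  noUniversal⇒fewNegativeEdges none
    with noUniversal⇒Path₄ none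
  ... | P with branch-dichotomy (Path₄.bc P) (Path₄.cd P) (Path₄.b≢d P ∘ sym)
             | branch-dichotomy (Adj-sym G (Path₄.bc P)) (Adj-sym G (Path₄.ab P)) (Path₄.a≢c P)
  ...   | inj₁ few | _        = few
  ...   | inj₂ _   | inj₁ few = few
  ...   | inj₂ (B , closedB , |B|≤) | inj₂ (C , closedC , |C|≤) = ⊥-elim (ℕ.1+n≰n (ℕ.≤-trans covered small))
    where
    covered : suc n ≤ length (members B) + length (members C)
    covered = subst₂ _≤_ (length-tabulate id) (length-++ (members B))
      (length-≤-⊆ {ys = members B ++ members C} (Unique.allFin⁺ (suc n)) λ {v} _ →
        [ ∈-++⁺ˡ , ∈-++⁺ʳ (members B) ] (closedBranches-cover (Path₄.bc P) B closedB C closedC v))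
    small : length (members B) + length (members C) ≤ n
    small = ℕ.≤-trans (ℕ.+-mono-≤ |B|≤ (ℕ.≤-trans |C|≤ (ℕ.⌊n/2⌋≤⌈n/2⌉ n)))
                      (ℕ.≤-reflexive (ℕ.⌊n/2⌋+⌈n/2⌉≡n n))

mainTheorem3 : (n : ℕ) → 2 < n → (T : Graph (suc n)) → IsTree T →
    (RnaNumber T ⌈ n /2⌉ ⇔ Isomorphic T (star n))
mainTheorem3 n _ T (connected , acyclic) = mk⇔ rna⇒star star⇒rna
  where
  rna⇒star : RnaNumber T ⌈ n /2⌉ → Isomorphic T (star n)
  rna⇒star (_ , minimal) = decide (Fin.any? (universal? T))
    where
    decide : Dec (∃ (Universal T)) → Isomorphic T (star n)
    decide (yes (_ , universal)) = StarCentre⇒Isomorphic T (universal⇒StarCentre T acyclic universal)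
    decide (no none) =
      let f , few = noUniversal⇒fewNegativeEdges T connected acyclic (λ v universal → none (v , universal))
      in ⊥-elim (ℕ.≤⇒≯ (minimal f) few)

  star⇒rna : Isomorphic T (star n) → RnaNumber T ⌈ n /2⌉
  star⇒rna iso = StarCentre⇒rna T (proj₂ (Isomorphic⇒StarCentre T iso))
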